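{- Let $G$ be a directed graph with nonnegative arc capacities, a set $S$ of sources and a set $T$ of sinks. Start with the zero flow and perform the following procedure: iterate over the sources $s\in S$ in an arbitrary order; for each source $s$, iterate over the sinks $t\in T$ in an arbitrary order; for each pair $(s,t)$, compute a maximum $s$-to-$t$ flow in the current residual graph and augment the current flow by it (thereby saturating all $s$-to-$t$ residual paths). Then the flow obtained at the end is a maximum flow from $S$ to $T$, i.e.\ no residual path leads from any source to any sink.
   Context: A flow is an assignment of values to arcs, each between $0$ and the arc's capacity, such that for every vertex that is neither a source nor a sink the total flow entering equals the total flow leaving. The residual graph of a flow contains an arc $(u,v)$ if $(u,v)$ carries flow less than its capacity and the reverse arc $(v,u)$ if $(u,v)$ carries positive flow. A flow from $S$ to $T$ is maximum if it maximizes the amount of flow leaving $S$, equivalently if there is no residual path from a vertex of $S$ to a vertex of $T$.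
   Formalization: The arc capacities, and with them the maximum s-to-t flows chosen at each step of the procedure, take rational values. -}

module Defs where

open import Data.Nat using (ℕ; zero; suc; _+_)
open import Data.Fin using (Fin; zero; suc; splitAt; _↑ˡ_; _↑ʳ_) renaming (_≟_ to _≟ᶠ_)
open import Data.Fin.Subset using (Subset; _∈_; _∉_; ⁅_⁆)
open import Data.Rational using (ℚ; 0ℚ; _≤_; _<_) renaming (_+_ to _+ℚ_; _-_ to _-ℚ_)
open import Data.Bool using (if_then_else_)
open import Data.Sum using (inj₁; inj₂)
open import Data.Product using (Σ; _×_; _,_; ∃)
open import Data.List using (List; []; _∷_; concatMap; map)
open import Relation.Nullary.Decidable using (⌊_⌋)
open import Relation.Binary.PropositionalEquality using (_≡_)
open import Relation.Binary.Construct.Closure.ReflexiveTransitive using (Star)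
open import Relation.Nullary using (¬_)

record Network (n : ℕ) : Set where
  field
    m    : ℕ
    tail : Fin m → Fin n
    head : Fin m → Fin n
    cap  : Fin m → ℚ
open Network public

Assignment : ∀ {n} → Network n → Set
Assignment N = Fin (m N) → ℚ

sumFin : ∀ {k} → (Fin k → ℚ) → ℚ
sumFin {zero}  f = 0ℚ
sumFin {suc k} f = f zero +ℚ sumFin (λ i → f (suc i))

inflow : ∀ {n} (N : Network n) → Assignment N → Fin n → ℚ
inflow N f v = sumFin (λ e → if ⌊ head N e ≟ᶠ v ⌋ then f e else 0ℚ)

outflow : ∀ {n} (N : Network n) → Assignment N → Fin n → ℚ
outflow N f v = sumFin (λ e → if ⌊ tail N e ≟ᶠ v ⌋ then f e else 0ℚ)

record IsFlow {n} (N : Network n) (S T : Subset n) (f : Assignment N) : Set where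
  field
    nonneg       : ∀ e → 0ℚ ≤ f e
    capacity     : ∀ e → f e ≤ cap N e
    conservation : ∀ v → v ∉ S → v ∉ T → inflow N f v ≡ outflow N f v

-- The residual network of f: arc e (forward copy, index e ↑ˡ m) with residual
-- capacity cap e - f e, and its reverse (index m ↑ʳ e) with capacity f e.
Res : ∀ {n} (N : Network n) → Assignment N → Network n
Res N f = record
  { m    = m N + m N
  ; tail = λ i → [ tail N , head N ] (splitAt (m N) i)
  ; head = λ i → [ head N , tail N ] (splitAt (m N) i)
  ; cap  = λ i → [ (λ e → cap N e -ℚ f e) , f ] (splitAt (m N) i)
  }
  where open import Data.Sum using ([_,_])

PosArc : ∀ {n} → Network n → Fin n → Fin n → Set
PosArc N u v = ∃ λ e → tail N e ≡ u × head N e ≡ v × 0ℚ < cap N e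

-- Arcs of the residual graph of f: (u,v) with f(u,v) < cap, or reverse of an
-- arc carrying positive flow.  (0 < cap - f  ⇔  f < cap.)
ResidualArc : ∀ {n} (N : Network n) → Assignment N → Fin n → Fin n → Set
ResidualArc N f = PosArc (Res N f)

ResidualPath : ∀ {n} (N : Network n) → Assignment N → Fin n → Fin n → Set
ResidualPath N f = Star (ResidualArc N f)

record IsMaxFlow {n} (N : Network n) (S T : Subset n) (f : Assignment N) : Set where
  field
    flow  : IsFlow N S T f
    noAug : ∀ s t → s ∈ S → t ∈ T → ¬ ResidualPath N f s t

augment : ∀ {n} (N : Network n) (f : Assignment N) → Assignment (Res N f) → Assignment N
augment N f g e = (f e +ℚ g (e ↑ˡ m N)) -ℚ g (m N ↑ʳ e)

zeroFlow : ∀ {n} (N : Network n) → Assignment N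
zeroFlow N _ = 0ℚ

-- Run N f ps f' : starting from f and processing the (source, sink) pairs ps in
-- order, where for each pair (s,t) some maximum s-to-t flow g of the current
-- residual network is chosen and the current flow is augmented by g, the
-- procedure may end with f'.
data Run {n} (N : Network n) : Assignment N → List (Fin n × Fin n) → Assignment N → Set where
  done : ∀ {f} → Run N f [] f
  step : ∀ {f s t ps f'} (g : Assignment (Res N f)) →
         IsMaxFlow (Res N f) ⁅ s ⁆ ⁅ t ⁆ g →
         Run N (augment N f g) ps f' →
         Run N f ((s , t) ∷ ps) f'

schedule : ∀ {n} → List (Fin n) → (Fin n → List (Fin n)) → List (Fin n × Fin n)
schedule ss ts = concatMap (λ s → map (λ t → (s , t)) (ts s)) ss

-- Call a vertex set X closed for f if no residual arc of f leaves it.  The net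
-- flow that g sends out of X is the sum of the net outflows of its vertices; for
-- an (a,b)-flow this is the value of g if X separates a from b and 0 if X
-- contains both or neither, so it is nonnegative whenever g is maximum and X
-- contains a or misses b.  If X is closed for f, every arc leaving X is
-- saturated and no arc contributes positively; hence g carries nothing into X,
-- and X is still closed after augmenting f by g.  Once all sinks of a source s
-- are processed, the intersection of the sets reachable from s right after each
-- of its augmentations is closed, contains s and misses every sink, and it stays
-- closed for the rest of the run.  Reachable sets are only classically
-- decidable, so they are built in the double-negation monad, which suffices for
-- the negative conclusion.
module Submission where

open import Defs
import Data.Rational.Properties as ℚ
open import Algebra.Properties.CommutativeMonoid.Sum ℚ.+-0-commutativeMonoid
  using (sum; sum-cong-≗; ∑-distrib-+; ∑-comm)
open import Algebra.Properties.Group ℚ.+-0-group using (x∙y⁻¹≈ε⇒x≈y; x≈y⇒x∙y⁻¹≈ε)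
open import Data.Bool using (Bool; true; false; if_then_else_; _∧_)
open import Data.Bool.Properties using (if-eta; if-swap-then; T-≡; T-not-≡; ∧-zeroʳ)
open import Data.Fin using (Fin; zero; suc; _↑ˡ_; _↑ʳ_; splitAt; _≟_)
open import Data.Fin.Properties using (splitAt-↑ˡ; splitAt-↑ʳ)
open import Data.Fin.Subset using (Subset; _∈_; _∉_; ⁅_⁆)
open import Data.Fin.Subset.Properties using (x∈⁅y⁆⇒x≡y; x∈⁅x⁆)
open import Data.List using (List; []; _∷_; map; _++_)
open import Data.List.Membership.Propositional using (find) renaming (_∈_ to _∈ₗ_)
open import Data.List.Membership.Propositional.Properties using (∈-map⁻; ∈-concatMap⁻)
open import Data.List.Relation.Unary.All as All using (All; []; _∷_)
open import Data.List.Relation.Unary.All.Properties using (map⁺)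
open import Data.List.Relation.Unary.Any using (here; there)
open import Data.List.Relation.Unary.Unique.Propositional using (Unique)
open import Data.Nat as ℕ using (zero; suc)
open import Data.Product using (Σ; _×_; _,_)
open import Data.Rational using (ℚ; 0ℚ; _≤_; _<_; _+_; _-_; -_; _<?_)
open import Data.Rational.Solver using (module +-*-Solver)
open +-*-Solver using (solve; _:+_; _:-_; _:=_)
open import Data.Sum using (_⊎_; inj₁; inj₂)
open import Effect.Monad using (RawMonad)
open import Function using (_∘_; const; _⇔_; Equivalence)
open import Level using (0ℓ)
open import Relation.Binary.Construct.Closure.ReflexiveTransitive using (Star; ε; _◅_; _◅◅_)
open import Relation.Binary.PropositionalEquality
open import Relation.Nullary using (¬_; Dec; yes; no; contradiction)
open import Relation.Nullary.Decidable
  using (⌊_⌋; toWitness; fromWitness; fromWitnessFalse; ¬¬-excluded-middle)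
open import Relation.Nullary.Negation using (DoubleNegation; ¬¬-Monad)

open RawMonad (¬¬-Monad {a = 0ℓ}) using (_>>=_; _<$>_; pure)

p≤q⇒0≤q-p : ∀ {p q} → p ≤ q → 0ℚ ≤ q - p
p≤q⇒0≤q-p {p} {q} p≤q = subst (_≤ q - p) (ℚ.+-inverseʳ p) (ℚ.+-monoˡ-≤ (- p) p≤q)

0≤q-p⇒p≤q : ∀ {p q} → 0ℚ ≤ q - p → p ≤ q
0≤q-p⇒p≤q {p} {q} 0≤q-p =
  subst₂ _≤_ (ℚ.+-identityˡ p) (solve 2 (λ p q → q :- p :+ p := q) refl p q) (ℚ.+-monoˡ-≤ p 0≤q-p)

0≤p⇒0-p≤0 : ∀ {p} → 0ℚ ≤ p → 0ℚ - p ≤ 0ℚ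
0≤p⇒0-p≤0 {p} 0≤p = subst (_≤ 0ℚ) (sym (ℚ.+-identityˡ (- p))) (ℚ.neg-antimono-≤ 0≤p)

0-p≡0⇒p≡0 : ∀ {p} → 0ℚ - p ≡ 0ℚ → p ≡ 0ℚ
0-p≡0⇒p≡0 {p} eq = sym (x∙y⁻¹≈ε⇒x≈y 0ℚ p eq)

0≤p⇒0<q-p⇒0<q : ∀ {p q} → 0ℚ ≤ p → 0ℚ < q - p → 0ℚ < q
0≤p⇒0<q-p⇒0<q {p} {q} 0≤p 0<q-p =
  ℚ.<-≤-trans 0<q-p (subst (q - p ≤_) (ℚ.+-identityʳ q) (ℚ.+-monoʳ-≤ q (ℚ.neg-antimono-≤ 0≤p)))

0<p+q⇒0<p⊎0<q : ∀ p q → 0ℚ < p + q → 0ℚ < p ⊎ 0ℚ < q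
0<p+q⇒0<p⊎0<q p q 0<p+q with 0ℚ <? p | 0ℚ <? q
... | yes 0<p | _       = inj₁ 0<p
... | no _    | yes 0<q = inj₂ 0<q
... | no 0≮p  | no 0≮q  =
  contradiction (ℚ.<-≤-trans 0<p+q (ℚ.+-mono-≤ (ℚ.≮⇒≥ 0≮p) (ℚ.≮⇒≥ 0≮q))) (ℚ.<-irrefl refl)

0≤q⇒p≤p+q : ∀ {p q} → 0ℚ ≤ q → p ≤ p + q
0≤q⇒p≤p+q {p} {q} 0≤q = subst (_≤ p + q) (ℚ.+-identityʳ p) (ℚ.+-monoʳ-≤ p 0≤q)

0≤p+q⇒q≤0⇒0≤p : ∀ {p q} → 0ℚ ≤ p + q → q ≤ 0ℚ → 0ℚ ≤ p
0≤p+q⇒q≤0⇒0≤p {p} {q} 0≤p+q q≤0 =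
  ℚ.≤-trans 0≤p+q (subst (p + q ≤_) (ℚ.+-identityʳ p) (ℚ.+-monoʳ-≤ p q≤0))

-- Finite sums

sumFin≡sum : ∀ {k} (f : Fin k → ℚ) → sumFin f ≡ sum f
sumFin≡sum {zero}  f = refl
sumFin≡sum {suc k} f = cong (f zero +_) (sumFin≡sum (f ∘ suc))

sum-cong : ∀ {k} {f g : Fin k → ℚ} → (∀ i → f i ≡ g i) → sumFin f ≡ sumFin g
sum-cong {zero}  f≗g = refl
sum-cong {suc k} f≗g = cong₂ _+_ (f≗g zero) (sum-cong (f≗g ∘ suc))

sum-zero : ∀ {k} {f : Fin k → ℚ} → (∀ i → f i ≡ 0ℚ) → sumFin f ≡ 0ℚ
sum-zero {zero}  f≗0 = refl
sum-zero {suc k} f≗0 = cong₂ _+_ (f≗0 zero) (sum-zero (f≗0 ∘ suc))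

sum-+ : ∀ {k} (f g : Fin k → ℚ) → sumFin (λ i → f i + g i) ≡ sumFin f + sumFin g
sum-+ f g = begin
  sumFin (λ i → f i + g i) ≡⟨ sumFin≡sum (λ i → f i + g i) ⟩
  sum (λ i → f i + g i)    ≡⟨ ∑-distrib-+ f g ⟩
  sum f + sum g            ≡⟨ sym (cong₂ _+_ (sumFin≡sum f) (sumFin≡sum g)) ⟩
  sumFin f + sumFin g      ∎
  where open ≡-Reasoning

sum-- : ∀ {k} (f g : Fin k → ℚ) → sumFin (λ i → f i - g i) ≡ sumFin f - sumFin g
sum-- {zero}  f g = refl
sum-- {suc k} f g =
  trans (cong (f zero - g zero +_) (sum-- (f ∘ suc) (g ∘ suc)))
        (solve 4 (λ a b c d → a :- b :+ (c :- d) := a :+ c :- (b :+ d)) refl (f zero) (g zero) _ _)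

sum-swap : ∀ {k l} (f : Fin k → Fin l → ℚ) →
  sumFin (λ i → sumFin (f i)) ≡ sumFin (λ j → sumFin (λ i → f i j))
sum-swap f = begin
  sumFin (λ i → sumFin (f i))         ≡⟨ sumFin≡sum (λ i → sumFin (f i)) ⟩
  sum (λ i → sumFin (f i))            ≡⟨ sum-cong-≗ (λ i → sumFin≡sum (f i)) ⟩
  sum (λ i → sum (f i))               ≡⟨ ∑-comm f ⟩
  sum (λ j → sum (λ i → f i j))       ≡⟨ sum-cong-≗ (λ j → sym (sumFin≡sum (λ i → f i j))) ⟩
  sum (λ j → sumFin (λ i → f i j))    ≡⟨ sym (sumFin≡sum (λ j → sumFin (λ i → f i j))) ⟩
  sumFin (λ j → sumFin (λ i → f i j)) ∎
  where open ≡-Reasoning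

sum-nonneg : ∀ {k} {f : Fin k → ℚ} → (∀ i → 0ℚ ≤ f i) → 0ℚ ≤ sumFin f
sum-nonneg {zero}  0≤f = ℚ.≤-refl
sum-nonneg {suc k} 0≤f = ℚ.+-mono-≤ (0≤f zero) (sum-nonneg (0≤f ∘ suc))

sum-nonpos : ∀ {k} {f : Fin k → ℚ} → (∀ i → f i ≤ 0ℚ) → sumFin f ≤ 0ℚ
sum-nonpos {zero}  f≤0 = ℚ.≤-refl
sum-nonpos {suc k} f≤0 = ℚ.+-mono-≤ (f≤0 zero) (sum-nonpos (f≤0 ∘ suc))

sum-nonpos-zero : ∀ {k} {f : Fin k → ℚ} → (∀ i → f i ≤ 0ℚ) → 0ℚ ≤ sumFin f → ∀ i → f i ≡ 0ℚ
sum-nonpos-zero {suc k} {f} f≤0 0≤Σf zero =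
  ℚ.≤-antisym (f≤0 zero) (0≤p+q⇒q≤0⇒0≤p 0≤Σf (sum-nonpos (f≤0 ∘ suc)))
sum-nonpos-zero {suc k} {f} f≤0 0≤Σf (suc i) =
  sum-nonpos-zero (f≤0 ∘ suc)
    (0≤p+q⇒q≤0⇒0≤p (subst (0ℚ ≤_) (ℚ.+-comm (f zero) _) 0≤Σf) (f≤0 zero)) i

sum-splitAt : ∀ m {k} (f : Fin (m ℕ.+ k) → ℚ) →
  sumFin f ≡ sumFin (λ i → f (i ↑ˡ k)) + sumFin (λ i → f (m ↑ʳ i))
sum-splitAt zero    f = sym (ℚ.+-identityˡ _)
sum-splitAt (suc m) f =
  trans (cong (f zero +_) (sum-splitAt m (f ∘ suc))) (sym (ℚ.+-assoc (f zero) _ _))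

sumWhere : ∀ {k} → (Fin k → Bool) → (Fin k → ℚ) → ℚ
sumWhere c x = sumFin (λ i → if c i then x i else 0ℚ)

if-distrib₂ : ∀ (_∙_ : ℚ → ℚ → ℚ) → 0ℚ ∙ 0ℚ ≡ 0ℚ → ∀ b {x y} →
  (if b then x ∙ y else 0ℚ) ≡ (if b then x else 0ℚ) ∙ (if b then y else 0ℚ)
if-distrib₂ _∙_ 0∙0≡0 true  = refl
if-distrib₂ _∙_ 0∙0≡0 false = sym 0∙0≡0

sumWhere-+ : ∀ {k} c (x y : Fin k → ℚ) → sumWhere c (λ i → x i + y i) ≡ sumWhere c x + sumWhere c y
sumWhere-+ {k} c x y = trans (sum-cong (λ i → if-distrib₂ _+_ refl (c i))) (sum-+ {k} _ _)

sumWhere-- : ∀ {k} c (x y : Fin k → ℚ) → sumWhere c (λ i → x i - y i) ≡ sumWhere c x - sumWhere c y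
sumWhere-- {k} c x y = trans (sum-cong (λ i → if-distrib₂ _-_ refl (c i))) (sum-- {k} _ _)

if-sum : ∀ {k} b (f : Fin k → ℚ) → (if b then sumFin f else 0ℚ) ≡ sumFin (λ i → if b then f i else 0ℚ)
if-sum true  f = refl
if-sum {k} false f = sym (sum-zero {k} (λ _ → refl))

sumWhere-≟ : ∀ {k} (w : Fin k) (h : Fin k → ℚ) → sumWhere (λ v → ⌊ w ≟ v ⌋) h ≡ h w
sumWhere-≟ {suc k} zero    h =
  trans (cong (h zero +_) (sum-zero {k} (λ _ → refl))) (ℚ.+-identityʳ (h zero))
sumWhere-≟ {suc k} (suc w) h =
  trans (ℚ.+-identityˡ _) (trans (sum-cong suc-≟) (sumWhere-≟ w (h ∘ suc)))
  where
  suc-≟ : ∀ v → (if ⌊ suc w ≟ suc v ⌋ then h (suc v) else 0ℚ) ≡ (if ⌊ w ≟ v ⌋ then h (suc v) else 0ℚ)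
  suc-≟ v with w ≟ v
  ... | yes _ = refl
  ... | no  _ = refl

sumWhere-≟-cong : ∀ {n k} {s s′ : Fin k → Fin n} → (∀ e → s e ≡ s′ e) → ∀ v x →
  sumWhere (λ e → ⌊ s e ≟ v ⌋) x ≡ sumWhere (λ e → ⌊ s′ e ≟ v ⌋) x
sumWhere-≟-cong s≗s′ v x = sum-cong (λ e → cong (λ w → if ⌊ w ≟ v ⌋ then x e else 0ℚ) (s≗s′ e))

sum-supported-on-pair : ∀ {k} {a b : Fin k} (h : Fin k → ℚ) → a ≢ b →
  (∀ v → v ≢ a → v ≢ b → h v ≡ 0ℚ) → sumFin h ≡ h a + h b
sum-supported-on-pair {k} {a} {b} h a≢b vanishes =
  trans (sum-cong split) (trans (sum-+ {k} _ _) (cong₂ _+_ (sumWhere-≟ a h) (sumWhere-≟ b h)))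
  where
  split : ∀ v → h v ≡ (if ⌊ a ≟ v ⌋ then h v else 0ℚ) + (if ⌊ b ≟ v ⌋ then h v else 0ℚ)
  split v with a ≟ v | b ≟ v
  ... | yes refl | yes refl = contradiction refl a≢b
  ... | yes refl | no _     = sym (ℚ.+-identityʳ _)
  ... | no _     | yes refl = sym (ℚ.+-identityˡ _)
  ... | no a≢v   | no b≢v   = vanishes v (a≢v ∘ sym) (b≢v ∘ sym)

sumWhere-fibres : ∀ {n k} (sel : Fin k → Fin n) (χ : Fin n → Bool) (g : Fin k → ℚ) →
  sumWhere χ (λ v → sumWhere (λ e → ⌊ sel e ≟ v ⌋) g) ≡ sumWhere (χ ∘ sel) g
sumWhere-fibres {n} {k} sel χ g = begin
  sumWhere χ (λ v → sumWhere (λ e → ⌊ sel e ≟ v ⌋) g)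
    ≡⟨ sum-cong (λ v → if-sum {k} (χ v) _) ⟩
  sumFin (λ v → sumFin (λ e → if χ v then (if ⌊ sel e ≟ v ⌋ then g e else 0ℚ) else 0ℚ))
    ≡⟨ sum-swap {n} {k} _ ⟩
  sumFin (λ e → sumFin (λ v → if χ v then (if ⌊ sel e ≟ v ⌋ then g e else 0ℚ) else 0ℚ))
    ≡⟨ sum-cong (λ e → sum-cong (λ v → if-swap-then (χ v) ⌊ sel e ≟ v ⌋)) ⟩
  sumFin (λ e → sumWhere (λ v → ⌊ sel e ≟ v ⌋) (λ v → if χ v then g e else 0ℚ))
    ≡⟨ sum-cong (λ e → sumWhere-≟ (sel e) _) ⟩
  sumWhere (χ ∘ sel) g ∎
  where open ≡-Reasoning

-- Residual networks

module _ {n} (N : Network n) (f : Assignment N) (e : Fin (m N)) where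
  Res-tail-↑ˡ : tail (Res N f) (e ↑ˡ m N) ≡ tail N e
  Res-tail-↑ˡ rewrite splitAt-↑ˡ (m N) e (m N) = refl

  Res-head-↑ˡ : head (Res N f) (e ↑ˡ m N) ≡ head N e
  Res-head-↑ˡ rewrite splitAt-↑ˡ (m N) e (m N) = refl

  Res-cap-↑ˡ : cap (Res N f) (e ↑ˡ m N) ≡ cap N e - f e
  Res-cap-↑ˡ rewrite splitAt-↑ˡ (m N) e (m N) = refl

  Res-tail-↑ʳ : tail (Res N f) (m N ↑ʳ e) ≡ head N e
  Res-tail-↑ʳ rewrite splitAt-↑ʳ (m N) (m N) e = refl

  Res-head-↑ʳ : head (Res N f) (m N ↑ʳ e) ≡ tail N e
  Res-head-↑ʳ rewrite splitAt-↑ʳ (m N) (m N) e = refl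

  Res-cap-↑ʳ : cap (Res N f) (m N ↑ʳ e) ≡ f e
  Res-cap-↑ʳ rewrite splitAt-↑ʳ (m N) (m N) e = refl

data ResidualArcView {n} (M : Network n) (h : Assignment M) (u v : Fin n) : Set where
  forward  : ∀ e → tail M e ≡ u → head M e ≡ v → 0ℚ < cap M e - h e → ResidualArcView M h u v
  backward : ∀ e → head M e ≡ u → tail M e ≡ v → 0ℚ < h e → ResidualArcView M h u v

module _ {n} (M : Network n) (h : Assignment M) {u v : Fin n} where
  unview : ResidualArcView M h u v → ResidualArc M h u v
  unview (forward e refl refl 0<r) =
    e ↑ˡ m M , Res-tail-↑ˡ M h e , Res-head-↑ˡ M h e , subst (0ℚ <_) (sym (Res-cap-↑ˡ M h e)) 0<r
  unview (backward e refl refl 0<h) =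
    m M ↑ʳ e , Res-tail-↑ʳ M h e , Res-head-↑ʳ M h e , subst (0ℚ <_) (sym (Res-cap-↑ʳ M h e)) 0<h

  view : ResidualArc M h u v → ResidualArcView M h u v
  view (j , refl , refl , 0<c) with splitAt (m M) j
  ... | inj₁ e = forward e refl refl 0<c
  ... | inj₂ e = backward e refl refl 0<c

-- Flow across a cut

netOutflow : ∀ {n} (M : Network n) → Assignment M → Fin n → ℚ
netOutflow M g v = outflow M g v - inflow M g v

conserved⇒netOutflow≡0 : ∀ {n} (M : Network n) (g : Assignment M) v →
  inflow M g v ≡ outflow M g v → netOutflow M g v ≡ 0ℚ
conserved⇒netOutflow≡0 M g v = x≈y⇒x∙y⁻¹≈ε ∘ sym

crossing : ∀ {n} (M : Network n) → Assignment M → (Fin n → Bool) → Fin (m M) → ℚ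
crossing M g χ e = (if χ (tail M e) then g e else 0ℚ) - (if χ (head M e) then g e else 0ℚ)

cutFlow : ∀ {n} (M : Network n) → Assignment M → (Fin n → Bool) → ℚ
cutFlow M g χ = sumFin (crossing M g χ)

cutFlow≡sumWhere-netOutflow : ∀ {n} (M : Network n) (g : Assignment M) (χ : Fin n → Bool) →
  cutFlow M g χ ≡ sumWhere χ (netOutflow M g)
cutFlow≡sumWhere-netOutflow M g χ = begin
  cutFlow M g χ
    ≡⟨ sum-- {m M} _ _ ⟩
  sumWhere (χ ∘ tail M) g - sumWhere (χ ∘ head M) g
    ≡⟨ sym (cong₂ _-_ (sumWhere-fibres (tail M) χ g) (sumWhere-fibres (head M) χ g)) ⟩
  sumWhere χ (outflow M g) - sumWhere χ (inflow M g)
    ≡⟨ sym (sumWhere-- χ (outflow M g) (inflow M g)) ⟩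
  sumWhere χ (netOutflow M g) ∎
  where open ≡-Reasoning

Closed : ∀ {n} → (Fin n → Fin n → Set) → (Fin n → Bool) → Set
Closed R χ = ∀ u v → R u v → χ u ≡ true → χ v ≡ true

closed-star : ∀ {n} {R : Fin n → Fin n → Set} {χ u v} →
  Closed R χ → Star R u v → χ u ≡ true → χ v ≡ true
closed-star closed ε           u∈ = u∈
closed-star closed (uRw ◅ w⇝v) u∈ = closed-star closed w⇝v (closed _ _ uRw u∈)

module TwoTerminal {n} {M : Network n} {a b : Fin n} {g : Assignment M}
                   (a≢b : a ≢ b) (flow : IsFlow M ⁅ a ⁆ ⁅ b ⁆ g) where

  netOutflow≡0 : ∀ v → v ≢ a → v ≢ b → netOutflow M g v ≡ 0ℚ
  netOutflow≡0 v v≢a v≢b =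
    conserved⇒netOutflow≡0 M g v (IsFlow.conservation flow v (v≢a ∘ x∈⁅y⁆⇒x≡y a) (v≢b ∘ x∈⁅y⁆⇒x≡y b))

  cutFlow-terminals : ∀ χ →
    cutFlow M g χ ≡ (if χ a then netOutflow M g a else 0ℚ) + (if χ b then netOutflow M g b else 0ℚ)
  cutFlow-terminals χ =
    trans (cutFlow≡sumWhere-netOutflow M g χ) (sum-supported-on-pair _ a≢b outside-terminals)
    where
    outside-terminals : ∀ v → v ≢ a → v ≢ b → (if χ v then netOutflow M g v else 0ℚ) ≡ 0ℚ
    outside-terminals v v≢a v≢b with χ v
    ... | true  = netOutflow≡0 v v≢a v≢b
    ... | false = refl

  -- No arc crosses the cut given by the whole vertex set.
  source+sink≡0 : netOutflow M g a + netOutflow M g b ≡ 0ℚ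
  source+sink≡0 = trans (sym (cutFlow-terminals (const true))) (sum-zero (λ e → ℚ.+-inverseʳ (g e)))

module _ {n} {M : Network n} {g : Assignment M} {χ : Fin n → Bool} (0≤g : ∀ e → 0ℚ ≤ g e) where

  crossing-nonneg : Closed (ResidualArc M g) χ → ∀ e → 0ℚ ≤ crossing M g χ e
  crossing-nonneg closed e with χ (tail M e) in t∈ | χ (head M e) in h∈
  ... | true  | true  = ℚ.≤-reflexive (sym (ℚ.+-inverseʳ (g e)))
  ... | true  | false = subst (0ℚ ≤_) (sym (ℚ.+-identityʳ (g e))) (0≤g e)
  ... | false | false = ℚ.≤-refl
  ... | false | true  = p≤q⇒0≤q-p (ℚ.≮⇒≥ λ 0<g →
    contradiction (trans (sym t∈) (closed _ _ (unview M g (backward e refl refl 0<g)) h∈)) λ ())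

  module _ (g≤cap : ∀ e → g e ≤ cap M e) (closed : Closed (PosArc M) χ) where

    crossing-nonpos : ∀ e → crossing M g χ e ≤ 0ℚ
    crossing-nonpos e with χ (tail M e) in t∈ | χ (head M e) in h∈
    ... | true  | true  = ℚ.≤-reflexive (ℚ.+-inverseʳ (g e))
    ... | false | false = ℚ.≤-refl
    ... | false | true  = 0≤p⇒0-p≤0 (0≤g e)
    ... | true  | false = subst (_≤ 0ℚ) (sym (ℚ.+-identityʳ (g e)))
      (ℚ.≤-trans (g≤cap e) (ℚ.≮⇒≥ λ 0<cap →
        contradiction (trans (sym h∈) (closed _ _ (e , refl , refl , 0<cap) t∈)) λ ()))

    -- All crossings are ≤ 0, so a nonnegative total forces g to vanish on the arcs entering χ.
    residual-closed : 0ℚ ≤ cutFlow M g χ → Closed (ResidualArc M g) χ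
    residual-closed 0≤cut u v arc u∈ with view M g arc
    ... | forward e refl refl 0<r = closed _ _ (e , refl , refl , 0≤p⇒0<q-p⇒0<q (0≤g e) 0<r) u∈
    ... | backward e refl refl 0<g with χ (tail M e) in v∈
    ...   | true  = refl
    ...   | false = contradiction 0<g (ℚ.<-irrefl (sym g≡0))
      where
      g≡0 : g e ≡ 0ℚ
      g≡0 = 0-p≡0⇒p≡0 (subst (_≡ 0ℚ)
        (cong₂ (λ x y → (if x then g e else 0ℚ) - (if y then g e else 0ℚ)) v∈ u∈)
        (sum-nonpos-zero crossing-nonpos 0≤cut e))

¬¬-decidable : ∀ {n} (P : Fin n → Set) → DoubleNegation (∀ v → Dec (P v))
¬¬-decidable {zero}  P = pure λ ()
¬¬-decidable {suc n} P = do
  P0? ← ¬¬-excluded-middle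
  Psuc? ← ¬¬-decidable (P ∘ suc)
  pure λ { zero → P0? ; (suc v) → Psuc? v }

¬¬-separating-closed : ∀ {n} {R : Fin n → Fin n → Set} {a b} → ¬ Star R a b →
  DoubleNegation (Σ (Fin n → Bool) λ χ → Closed R χ × χ a ≡ true × χ b ≡ false)
¬¬-separating-closed {R = R} {a} {b} ¬a⇝b = do
  reach? ← ¬¬-decidable (Star R a)
  let reached : ∀ {v} → ⌊ reach? v ⌋ ≡ true → Star R a v
      reached = toWitness ∘ Equivalence.from T-≡
      marked : ∀ {v} → Star R a v → ⌊ reach? v ⌋ ≡ true
      marked = Equivalence.to T-≡ ∘ fromWitness
  pure ( (λ v → ⌊ reach? v ⌋)
       , (λ u v uRv u∈ → marked (reached u∈ ◅◅ (uRv ◅ ε)))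
       , marked ε
       , Equivalence.to T-not-≡ (fromWitnessFalse ¬a⇝b) )

maxFlow-value-nonneg : ∀ {n} {M : Network n} {a b} {g : Assignment M} → a ≢ b →
  IsMaxFlow M ⁅ a ⁆ ⁅ b ⁆ g → DoubleNegation (0ℚ ≤ netOutflow M g a)
maxFlow-value-nonneg {M = M} {a} {b} {g} a≢b max = do
  (χ , closed , a∈ , b∉) ← ¬¬-separating-closed (noAug a b (x∈⁅x⁆ a) (x∈⁅x⁆ b))
  pure (subst (0ℚ ≤_) (cutFlow≡value a∈ b∉) (sum-nonneg (crossing-nonneg {M = M} (nonneg flow) closed)))
  where
  open IsMaxFlow max
  open IsFlow
  cutFlow≡value : ∀ {χ} → χ a ≡ true → χ b ≡ false → cutFlow M g χ ≡ netOutflow M g a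
  cutFlow≡value {χ} a∈ b∉ rewrite TwoTerminal.cutFlow-terminals a≢b flow χ | a∈ | b∉ =
    ℚ.+-identityʳ _

-- Augmentation

module _ {n} (N : Network n) (f : Assignment N) (g : Assignment (Res N f)) where
  private
    M = Res N f

    g→ : Assignment N
    g→ e = g (e ↑ˡ m N)

    g← : Assignment N
    g← e = g (m N ↑ʳ e)

  residual-along : ∀ e → 0ℚ < (cap N e - f e) - g→ e ⊎ 0ℚ < g← e → ResidualArc M g (tail N e) (head N e)
  residual-along e (inj₁ 0<r) =
    unview M g (forward (e ↑ˡ m N) (Res-tail-↑ˡ N f e) (Res-head-↑ˡ N f e)
      (subst (λ c → 0ℚ < c - g→ e) (sym (Res-cap-↑ˡ N f e)) 0<r))
  residual-along e (inj₂ 0<g) =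
    unview M g (backward (m N ↑ʳ e) (Res-head-↑ʳ N f e) (Res-tail-↑ʳ N f e) 0<g)

  residual-against : ∀ e → 0ℚ < f e - g← e ⊎ 0ℚ < g→ e → ResidualArc M g (head N e) (tail N e)
  residual-against e (inj₁ 0<r) =
    unview M g (forward (m N ↑ʳ e) (Res-tail-↑ʳ N f e) (Res-head-↑ʳ N f e)
      (subst (λ c → 0ℚ < c - g← e) (sym (Res-cap-↑ʳ N f e)) 0<r))
  residual-against e (inj₂ 0<g) =
    unview M g (backward (e ↑ˡ m N) (Res-head-↑ˡ N f e) (Res-tail-↑ˡ N f e) 0<g)

  augment-residualArc : ∀ {u v} → ResidualArc N (augment N f g) u v → ResidualArc M g u v
  augment-residualArc arc with view N (augment N f g) arc
  ... | forward e refl refl 0<r = residual-along e (0<p+q⇒0<p⊎0<q _ _ (subst (0ℚ <_)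
    (solve 4 (λ c x y z → c :- ((x :+ y) :- z) := (c :- x :- y) :+ z)
             refl (cap N e) (f e) (g→ e) (g← e)) 0<r))
  ... | backward e refl refl 0<r = residual-against e (0<p+q⇒0<p⊎0<q _ _ (subst (0ℚ <_)
    (solve 3 (λ x y z → (x :+ y) :- z := (x :- z) :+ y) refl (f e) (g→ e) (g← e)) 0<r))

  private
    at : (Fin (m N) → Fin n) → Fin n → Fin (m N) → Bool
    at end v e = ⌊ end e ≟ v ⌋

  outflow-Res : ∀ v → outflow M g v ≡ sumWhere (at (tail N) v) g→ + sumWhere (at (head N) v) g←
  outflow-Res v = trans (sum-splitAt (m N) _)
    (cong₂ _+_ (sumWhere-≟-cong (Res-tail-↑ˡ N f) v g→) (sumWhere-≟-cong (Res-tail-↑ʳ N f) v g←))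

  inflow-Res : ∀ v → inflow M g v ≡ sumWhere (at (head N) v) g→ + sumWhere (at (tail N) v) g←
  inflow-Res v = trans (sum-splitAt (m N) _)
    (cong₂ _+_ (sumWhere-≟-cong (Res-head-↑ˡ N f) v g→) (sumWhere-≟-cong (Res-head-↑ʳ N f) v g←))

  sumWhere-augment : ∀ c → sumWhere c (augment N f g) ≡ (sumWhere c f + sumWhere c g→) - sumWhere c g←
  sumWhere-augment c = trans (sumWhere-- c _ g←) (cong (_- sumWhere c g←) (sumWhere-+ c f g→))

  netOutflow-augment : ∀ v → netOutflow N (augment N f g) v ≡ netOutflow N f v + netOutflow M g v
  netOutflow-augment v = begin
    netOutflow N (augment N f g) v
      ≡⟨ cong₂ _-_ (sumWhere-augment (at (tail N) v)) (sumWhere-augment (at (head N) v)) ⟩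
    (outflow N f v + T→ - T←) - (inflow N f v + H→ - H←)
      ≡⟨ solve 6 (λ o i t→ t← h→ h← → (o :+ t→ :- t←) :- (i :+ h→ :- h←)
                                     := (o :- i) :+ ((t→ :+ h←) :- (h→ :+ t←)))
               refl (outflow N f v) (inflow N f v) T→ T← H→ H← ⟩
    netOutflow N f v + ((T→ + H←) - (H→ + T←))
      ≡⟨ sym (cong (netOutflow N f v +_) (cong₂ _-_ (outflow-Res v) (inflow-Res v))) ⟩
    netOutflow N f v + netOutflow M g v ∎
    where
    open ≡-Reasoning
    T→ = sumWhere (at (tail N) v) g→
    T← = sumWhere (at (tail N) v) g←
    H→ = sumWhere (at (head N) v) g→
    H← = sumWhere (at (head N) v) g←

  augment-isFlow : ∀ {S T a b} → a ∈ S → b ∈ T →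
    IsFlow N S T f → IsFlow M ⁅ a ⁆ ⁅ b ⁆ g → IsFlow N S T (augment N f g)
  augment-isFlow {S} {T} {a} {b} a∈S b∈T f-flow g-flow = record
    { nonneg       = λ e → p≤q⇒0≤q-p (ℚ.≤-trans (g←≤f e) (0≤q⇒p≤p+q (nonneg g-flow (e ↑ˡ m N))))
    ; capacity     = λ e → 0≤q-p⇒p≤q (subst (0ℚ ≤_)
        (solve 4 (λ c x y z → (c :- x :- y) :+ z := c :- ((x :+ y) :- z))
                 refl (cap N e) (f e) (g→ e) (g← e))
        (ℚ.+-mono-≤ (p≤q⇒0≤q-p (g→≤cap-f e)) (nonneg g-flow (m N ↑ʳ e))))
    ; conservation = λ v v∉S v∉T → sym (x∙y⁻¹≈ε⇒x≈y _ _ (begin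
        netOutflow N (augment N f g) v      ≡⟨ netOutflow-augment v ⟩
        netOutflow N f v + netOutflow M g v ≡⟨ cong₂ _+_ (f-conserved v∉S v∉T) (g-conserved v∉S v∉T) ⟩
        0ℚ                                  ∎))
    }
    where
    open IsFlow
    open ≡-Reasoning
    g←≤f : ∀ e → g← e ≤ f e
    g←≤f e = subst (g← e ≤_) (Res-cap-↑ʳ N f e) (capacity g-flow (m N ↑ʳ e))
    g→≤cap-f : ∀ e → g→ e ≤ cap N e - f e
    g→≤cap-f e = subst (g→ e ≤_) (Res-cap-↑ˡ N f e) (capacity g-flow (e ↑ˡ m N))
    terminal∈ : ∀ {X : Subset n} {w v} → w ∈ X → v ∈ ⁅ w ⁆ → v ∈ X
    terminal∈ {X} {w} w∈X v∈⁅w⁆ = subst (_∈ X) (sym (x∈⁅y⁆⇒x≡y w v∈⁅w⁆)) w∈X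
    f-conserved : ∀ {v} → v ∉ S → v ∉ T → netOutflow N f v ≡ 0ℚ
    f-conserved {v} v∉S v∉T = conserved⇒netOutflow≡0 N f v (conservation f-flow v v∉S v∉T)
    g-conserved : ∀ {v} → v ∉ S → v ∉ T → netOutflow M g v ≡ 0ℚ
    g-conserved {v} v∉S v∉T = conserved⇒netOutflow≡0 M g v
      (conservation g-flow v (v∉S ∘ terminal∈ a∈S) (v∉T ∘ terminal∈ b∈T))

augment-preserves-closed : ∀ {n} {N : Network n} {f} {g : Assignment (Res N f)} {a b} {χ} →
  a ≢ b → IsMaxFlow (Res N f) ⁅ a ⁆ ⁅ b ⁆ g → χ a ≡ true ⊎ χ b ≡ false →
  Closed (ResidualArc N f) χ → DoubleNegation (Closed (ResidualArc N (augment N f g)) χ)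
augment-preserves-closed {N = N} {f} {g} {a} {b} {χ} a≢b max a∈⊎b∉ closed = do
  0≤terminals ← ¬¬-0≤terminals (χ a) (χ b) a∈⊎b∉
  let 0≤cut = subst (0ℚ ≤_) (sym (cutFlow-terminals χ)) 0≤terminals
  pure λ u v arc → residual-closed {M = Res N f} (nonneg flow) (capacity flow) closed 0≤cut u v
                 (augment-residualArc N f g arc)
  where
  open IsMaxFlow max
  open IsFlow
  open TwoTerminal a≢b flow
  ¬¬-0≤terminals : ∀ x y → x ≡ true ⊎ y ≡ false → DoubleNegation
    (0ℚ ≤ (if x then netOutflow (Res N f) g a else 0ℚ) + (if y then netOutflow (Res N f) g b else 0ℚ))
  ¬¬-0≤terminals true  true  _ = pure (ℚ.≤-reflexive (sym source+sink≡0))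
  ¬¬-0≤terminals true  false _ = subst (0ℚ ≤_) (sym (ℚ.+-identityʳ _)) <$> maxFlow-value-nonneg a≢b max
  ¬¬-0≤terminals false false _ = pure ℚ.≤-refl
  ¬¬-0≤terminals false true (inj₁ ())
  ¬¬-0≤terminals false true (inj₂ ())

∧≡true⇒≡true : ∀ {x y} → x ∧ y ≡ true → x ≡ true × y ≡ true
∧≡true⇒≡true {true} {true} _ = refl , refl

∧-closed : ∀ {n} {R : Fin n → Fin n → Set} {χ₁ χ₂ : Fin n → Bool} →
  Closed R χ₁ → Closed R χ₂ → Closed R (λ v → χ₁ v ∧ χ₂ v)
∧-closed closed₁ closed₂ u v uRv u∈ with ∧≡true⇒≡true u∈
... | u∈₁ , u∈₂ rewrite closed₁ u v uRv u∈₁ | closed₂ u v uRv u∈₂ = refl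

-- Runs of the procedure

∈-schedule⁻ : ∀ {n} (ss : List (Fin n)) (ts : Fin n → List (Fin n)) {s t} →
  (s , t) ∈ₗ schedule ss ts → s ∈ₗ ss × t ∈ₗ ts s
∈-schedule⁻ ss ts st∈ with find (∈-concatMap⁻ (λ s → map (λ t → (s , t)) (ts s)) {xs = ss} st∈)
... | s , s∈ss , st∈s with ∈-map⁻ (λ t → (s , t)) st∈s
...   | _ , t∈ts , refl = s∈ss , t∈ts

All-schedule : ∀ {n} {P : Fin n × Fin n → Set} ss ts →
  (∀ {s t} → s ∈ₗ ss → t ∈ₗ ts s → P (s , t)) → All P (schedule ss ts)
All-schedule ss ts P-pairs =
  All.tabulate λ {(s , t)} st∈ → let s∈ , t∈ = ∈-schedule⁻ ss ts st∈ in P-pairs s∈ t∈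

zeroFlow-isFlow : ∀ {n} (N : Network n) {S T} → (∀ e → 0ℚ ≤ cap N e) → IsFlow N S T (zeroFlow N)
zeroFlow-isFlow N 0≤cap = record
  { nonneg       = λ _ → ℚ.≤-refl
  ; capacity     = 0≤cap
  ; conservation = λ _ _ _ →
      trans (sum-zero {m N} (λ _ → if-eta _)) (sym (sum-zero {m N} (λ _ → if-eta _)))
  }

module _ {n} (N : Network n) where

  run-isFlow : ∀ {S T f ps f′} → All (λ (s , t) → s ∈ S × t ∈ T) ps → Run N f ps f′ →
    IsFlow N S T f → IsFlow N S T f′
  run-isFlow []                  done             f-flow = f-flow
  run-isFlow ((s∈S , t∈T) ∷ sts) (step g max run) f-flow =
    run-isFlow sts run (augment-isFlow N _ g s∈S t∈T f-flow (IsMaxFlow.flow max))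

  Admissible : (Fin n → Bool) → Fin n × Fin n → Set
  Admissible χ (s , t) = s ≢ t × (χ s ≡ true ⊎ χ t ≡ false)

  run-preserves-closed : ∀ {χ f ps f′} → All (Admissible χ) ps → Run N f ps f′ →
    Closed (ResidualArc N f) χ → DoubleNegation (Closed (ResidualArc N f′) χ)
  run-preserves-closed []                    done             closed = pure closed
  run-preserves-closed ((s≢t , s∈⊎t∉) ∷ sts) (step g max run) closed =
    augment-preserves-closed {N = N} s≢t max s∈⊎t∉ closed >>= run-preserves-closed sts run

  run-++ : ∀ ps {qs f f′} → Run N f (ps ++ qs) f′ →
    Σ (Assignment N) λ f₁ → Run N f ps f₁ × Run N f₁ qs f′
  run-++ []       run              = _ , done , run
  run-++ (_ ∷ ps) (step g max run) with run-++ ps run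
  ... | f₁ , run₁ , run₂ = f₁ , step g max run₁ , run₂

  run-separates-source : ∀ s ts {f f′} → All (s ≢_) ts → Run N f (map (λ t → (s , t)) ts) f′ →
    DoubleNegation (Σ (Fin n → Bool) λ χ →
      Closed (ResidualArc N f′) χ × χ s ≡ true × All (λ t → χ t ≡ false) ts)
  run-separates-source s []       []            done = pure (const true , (λ _ _ _ _ → refl) , refl , [])
  run-separates-source s (t ∷ ts) {f} (s≢t ∷ s≢ts) (step g max run) = do
    (χ₁ , closed₁ , s∈₁ , t∉₁) ← ¬¬-separating-closed (IsMaxFlow.noAug max s t (x∈⁅x⁆ s) (x∈⁅x⁆ t))
    closed₁′ ← run-preserves-closed (map⁺ (All.map (_, inj₁ s∈₁) s≢ts)) run
                                    (λ u v → closed₁ u v ∘ augment-residualArc N f g)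
    (χ₂ , closed₂ , s∈₂ , ts∉₂) ← run-separates-source s ts s≢ts run
    pure ( (λ v → χ₁ v ∧ χ₂ v)
         , ∧-closed closed₁′ closed₂
         , cong₂ _∧_ s∈₁ s∈₂
         , cong (_∧ χ₂ t) t∉₁
           ∷ All.map (λ {t′} t′∉₂ → trans (cong (χ₁ t′ ∧_) t′∉₂) (∧-zeroʳ (χ₁ t′))) ts∉₂ )

  module _ {S T : Subset n} (ts : Fin n → List (Fin n)) (S∩T≡∅ : ∀ v → v ∈ S → v ∉ T)
           (ts≡T : ∀ s t → t ∈ₗ ts s ⇔ t ∈ T) where

    source≢sink : ∀ {s t} → s ∈ S → t ∈ T → s ≢ t
    source≢sink s∈S t∈T refl = S∩T≡∅ _ s∈S t∈T

    run-separates-sources : ∀ ss {f f′} → (∀ s → s ∈ₗ ss → s ∈ S) → Run N f (schedule ss ts) f′ →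
      ∀ {s} → s ∈ₗ ss → DoubleNegation (Σ (Fin n → Bool) λ χ →
        Closed (ResidualArc N f′) χ × χ s ≡ true × (∀ t → t ∈ T → χ t ≡ false))
    run-separates-sources (s ∷ ss) ss⊆S run (here refl) with run-++ (map (λ t → (s , t)) (ts s)) run
    ... | _ , run₁ , run₂ = do
      (χ , closed , s∈ , ts∉) ← run-separates-source s (ts s)
        (All.tabulate λ t∈ → source≢sink (ss⊆S s (here refl)) (Equivalence.to (ts≡T s _) t∈)) run₁
      let T∉ : ∀ t → t ∈ T → χ t ≡ false
          T∉ t t∈T = All.lookup ts∉ (Equivalence.from (ts≡T s t) t∈T)
      closed′ ← run-preserves-closed (All-schedule ss ts λ s′∈ t′∈ →
                  let t′∈T = Equivalence.to (ts≡T _ _) t′∈ in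
                  source≢sink (ss⊆S _ (there s′∈)) t′∈T , inj₂ (T∉ _ t′∈T)) run₂ closed
      pure (χ , closed′ , s∈ , T∉)
    run-separates-sources (s ∷ ss) ss⊆S run (there s∈ss) with run-++ (map (λ t → (s , t)) (ts s)) run
    ... | _ , _ , run₂ = run-separates-sources ss (λ s′ → ss⊆S s′ ∘ there) run₂ s∈ss

theorem3 : ∀ {n} (N : Network n) (S T : Subset n) →
    (∀ e → 0ℚ ≤ cap N e) →
    (∀ v → v ∈ S → v ∉ T) →
    (ss : List (Fin n)) → Unique ss → (∀ v → (v ∈ₗ ss) ⇔ (v ∈ S)) →
    (ts : Fin n → List (Fin n)) → (∀ s → Unique (ts s)) →
    (∀ s v → (v ∈ₗ ts s) ⇔ (v ∈ T)) →
    (f : Assignment N) → Run N (zeroFlow N) (schedule ss ts) f →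
    IsMaxFlow N S T f
-- Repeated pairs are processed like any others.
theorem3 N S T 0≤cap S∩T≡∅ ss _ ss≡S ts _ ts≡T f run = record
  { flow  = run-isFlow N
      (All-schedule ss ts λ s∈ t∈ → Equivalence.to (ss≡S _) s∈ , Equivalence.to (ts≡T _ _) t∈)
      run (zeroFlow-isFlow N 0≤cap)
  ; noAug = λ s t s∈S t∈T s⇝t →
      run-separates-sources N ts S∩T≡∅ ts≡T ss (λ s′ → Equivalence.to (ss≡S s′)) run
        (Equivalence.from (ss≡S s) s∈S)
        λ (χ , closed , s∈ , T∉) →
          contradiction (trans (sym (T∉ t t∈T)) (closed-star closed s⇝t s∈)) λ ()
  }
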